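{- Let $n\ge 3$ be odd, let $k\ge 1$ be an integer, and let $c$ be an integer with $1\le c\le k$. Let $G_{n,k,-c}$ be the unicyclic graph consisting of a cycle $C_n$ with vertices $a_1,a_2,\dots,a_n$ (in cyclic order), together with $k$ pendant vertices attached to each of $a_1,\dots,a_{n-1}$ and $k-c$ pendant vertices attached to $a_n$ (so $G_{n,k,-c}$ has $p=q=n(k+1)-c$ vertices and edges). Then $G_{n,k,-c}$ is super edge-magic total and $$sm(G_{n,k,-c})=2n(k+1)-2c+\frac{n+3}{2}.$$
   Context: All graphs are finite, simple and undirected. For a graph $G$ with $p$ vertices and $q$ edges, a super edge-magic total labeling is a bijection $f\colon V(G)\cup E(G)\to\{1,2,\dots,p+q\}$ with $f(V(G))=\{1,\dots,p\}$ such that $f(u)+f(v)+f(uv)$ equals a constant $c(f)$ (the magic constant) for every edge $uv\in E(G)$. $G$ is super edge-magic total if it admits such a labeling, and its super edge-magic total strength $sm(G)$ is the minimum of $c(f)$ over all super edge-magic total labelings $f$ of $G$. -}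

module Defs where

open import Data.Nat using (ℕ; zero; suc; _+_; _*_; _∸_; _≤_; _<_; _≟_)
open import Data.Nat.DivMod using (_%_; m%n<n)
open import Data.Fin using (Fin; toℕ; fromℕ<)
open import Data.Product using (Σ; _×_; _,_; proj₁; proj₂)
open import Data.Sum using (_⊎_; inj₁; inj₂)
open import Data.Bool using (if_then_else_)
open import Relation.Nullary using (does)
open import Relation.Binary.PropositionalEquality using (_≡_)
open import Function.Bundles using (_⤖_; Bijection)

-- A finite graph given by a vertex type V, an edge type E, and the
-- endpoint map of every edge, together with the numbers p and q that are
-- meant to be |V| and |E|.  (Simplicity is not part of this record; the
-- concrete graph below is simple.)
record Graph : Set₁ where
  field
    V    : Set
    E    : Set
    ends : E → V × V
    p    : ℕ
    q    : ℕ

open Graph public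

-- A total labeling: a bijection V ⊎ E → {1,…,p+q}.  Internally it is a
-- bijection onto Fin (p + q); the actual label of x is 1 + toℕ (L x).
TotalLabeling : Graph → Set
TotalLabeling G = (V G ⊎ E G) ⤖ Fin (p G + q G)

label : (G : Graph) → TotalLabeling G → V G ⊎ E G → ℕ
label G L x = suc (toℕ (Bijection.to L x))

IsSEMTLabeling : (G : Graph) → TotalLabeling G → ℕ → Set
IsSEMTLabeling G L c =
  ((v : V G) → label G L (inj₁ v) ≤ p G)
  × ((e : E G) → p G < label G L (inj₂ e))
  × ((e : E G) → label G L (inj₁ (proj₁ (ends G e)))
                 + label G L (inj₁ (proj₂ (ends G e)))
                 + label G L (inj₂ e) ≡ c)

HasSEMTWithConstant : Graph → ℕ → Set
HasSEMTWithConstant G c = Σ (TotalLabeling G) λ L → IsSEMTLabeling G L c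

IsSuperEdgeMagicTotal : Graph → Set
IsSuperEdgeMagicTotal G = Σ ℕ λ c → HasSEMTWithConstant G c

IsSMStrength : Graph → ℕ → Set
IsSMStrength G m =
  HasSEMTWithConstant G m × ((c : ℕ) → HasSEMTWithConstant G c → m ≤ c)

next : {n : ℕ} → Fin n → Fin n
next {suc m} i = fromℕ< (m%n<n (suc (toℕ i)) (suc m))

-- Cycle vertices a₁,…,aₙ are Fin n (aⱼ is index j-1; aₙ is index n-1).
-- Number of pendant vertices at cycle vertex i: k, except k - c at aₙ.
pendCount : (n k c : ℕ) → Fin n → ℕ
pendCount n k c i = if does (suc (toℕ i) ≟ n) then k ∸ c else k

Pendant : (n k c : ℕ) → Set
Pendant n k c = Σ (Fin n) λ i → Fin (pendCount n k c i)

G-ends : (n k c : ℕ) → (Fin n ⊎ Pendant n k c) → (Fin n ⊎ Pendant n k c) × (Fin n ⊎ Pendant n k c)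
G-ends n k c (inj₁ i) = inj₁ i , inj₁ (next i)
G-ends n k c (inj₂ (i , j)) = inj₁ i , inj₂ (i , j)

G[_,_,-_] : (n k c : ℕ) → Graph
G[ n , k ,- c ] = record
  { V    = Fin n ⊎ Pendant n k c
  ; E    = Fin n ⊎ Pendant n k c
  ; ends = G-ends n k c
  ; p    = n * (k + 1) ∸ c
  ; q    = n * (k + 1) ∸ c
  }

-- Write n = 2h + 1 and N = p = q = n(k + 1) − c.
--
-- Summing the magic equation over the N edges gives
-- N·m = (1 + 2 + ⋯ + 2N) + Σₑ f(tail e), since the heads of the edges
-- (aᵢ₊₁ for the cycle edge aᵢaᵢ₊₁, the pendant for a pendant edge) run
-- through every vertex exactly once.  Each of a₁, …, aₙ₋₁ is the tail of
-- k + 1 edges and aₙ of at least one, and the labels of the aᵢ are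
-- distinct, so Σₑ f(tail e) ≥ n(n + 1)/2 + k·n(n − 1)/2 = n + (k + 1)hn,
-- which is more than hN.  Hence m > 2N + h + 1.
--
-- Give a₁, a₂, …, aₙ the labels 1, h + 2, 2, h + 3, …, h + 1:
-- then the edges aᵢaᵢ₊₁ have pairwise distinct label sums f(aᵢ) + f(aᵢ₊₁)
-- filling an interval, and the pendants can be numbered so that the sums
-- along pendant edges continue that interval.  Labelling the edges in
-- decreasing order of these sums makes all edge weights equal 2N + h + 2.
module Submission where

open import Data.Fin as Fin using (Fin; toℕ; fromℕ; fromℕ<; inject₁; splitAt; remQuot; cast; punchOut)
open import Data.Fin.Permutation using (cast-id; reverse)
open import Data.Fin.Properties
  using ( toℕ<n; toℕ-fromℕ; toℕ-inject₁; toℕ-fromℕ<; toℕ-injective; toℕ-↑ˡ; toℕ-↑ʳ; toℕ-combine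
        ; toℕ-cast; cast-involutive; opposite-prop; fromℕ<-injective; inject₁-injective
        ; punchIn-injective; punchOut-injective; injective⇒≤; any?; +↔⊎; *↔×; _≟_)
open import Data.Fin.Relation.Unary.Top using (view; ‵fromℕ; ‵inject₁; view-fromℕ; view-inject₁)
open import Data.Nat as ℕ using (ℕ; zero; suc; _+_; _*_; _∸_; _≤_; _<_; z≤n; s≤s; _≤?_; _/_)
open import Data.Nat.DivMod using (_%_; m<n⇒m%n≡m; n%n≡0; m≡m%n+[m/n]*n; m*n/n≡m)
open import Data.Nat.Properties hiding (_≟_)
open import Algebra.Properties.CommutativeMonoid.Sum +-0-commutativeMonoid
  using (sum-syntax; sum-cong-≗; sum-remove; sum-init-last; ∑-distrib-+; ∑-permute)
open import Data.Nat.Tactic.RingSolver using (solve-∀)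
open import Data.Product as Product using (∃; _×_; _,_; proj₁; proj₂; swap)
open import Data.Product.Function.NonDependent.Propositional using (_×-↔_)
open import Data.Sum as Sum using (_⊎_; inj₁; inj₂; [_,_]′)
open import Data.Sum.Function.Propositional using (_⊎-↔_)
open import Data.Sum.Properties using (inj₁-injective)
open import Data.Vec.Functional using (removeAt)
open import Function using (_∘_; Injective)
open import Function.Bundles using (_↔_; Inverse; Bijection; mk⤖; mk↔ₛ′)
open import Function.Construct.Composition using (_↔-∘_)
open import Function.Construct.Identity using (↔-id)
open import Function.Construct.Symmetry using (↔-sym)
open import Function.Properties.Bijection using (⤖⇒↔)
open import Function.Properties.Inverse using (↔⇒⤖)
open import Relation.Binary.PropositionalEquality
open import Relation.Nullary using (yes; no; contradiction)
open import Relation.Nullary.Decidable using (dec-true; dec-false)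

open import Defs

open Inverse using (to; from)

-- Finite sums

∑-splitAt : ∀ m {n} (g : Fin m ⊎ Fin n → ℕ) →
  ∑[ x < m + n ] g (splitAt m x) ≡ ∑[ i < m ] g (inj₁ i) + ∑[ j < n ] g (inj₂ j)
∑-splitAt zero    g = refl
∑-splitAt (suc m) g = trans (cong (g (inj₁ Fin.zero) +_) (∑-splitAt m (g ∘ Sum.map₁ Fin.suc)))
                            (sym (+-assoc (g (inj₁ Fin.zero)) _ _))

∑-remQuot : ∀ m n (g : Fin m × Fin n → ℕ) →
  ∑[ x < m * n ] g (remQuot n x) ≡ ∑[ i < m ] ∑[ j < n ] g (i , j)
∑-remQuot zero    n g = refl
∑-remQuot (suc m) n g =
  trans (∑-splitAt n (g ∘ swap ∘ [ (_, Fin.zero) , Product.map₂ Fin.suc ∘ swap ∘ remQuot {m} n ]′))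
        (cong (∑[ j < n ] g (Fin.zero , j) +_) (∑-remQuot m n (g ∘ Product.map₁ Fin.suc)))

∑-const : ∀ n a → ∑[ i < n ] a ≡ n * a
∑-const zero    a = refl
∑-const (suc n) a = cong (a +_) (∑-const n a)

triangular : ℕ → ℕ
triangular n = ∑[ i < n ] suc (toℕ i)

triangular-suc : ∀ n → triangular (suc n) ≡ triangular n + suc n
triangular-suc n = trans (sum-init-last {n} (suc ∘ toℕ))
  (cong₂ _+_ (sum-cong-≗ {n} (cong suc ∘ toℕ-inject₁)) (cong suc (toℕ-fromℕ n)))

2*triangular : ∀ n → 2 * triangular n ≡ n * suc n
2*triangular zero    = refl
2*triangular (suc n) = begin
  2 * triangular (suc n)        ≡⟨ cong (2 *_) (triangular-suc n) ⟩
  2 * (triangular n + suc n)    ≡⟨ *-distribˡ-+ 2 (triangular n) (suc n) ⟩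
  2 * triangular n + 2 * suc n  ≡⟨ cong (_+ 2 * suc n) (2*triangular n) ⟩
  n * suc n + 2 * suc n         ≡⟨ *-distribʳ-+ (suc n) n 2 ⟨
  (n + 2) * suc n               ≡⟨ *-comm (n + 2) (suc n) ⟩
  suc n * (n + 2)               ≡⟨ cong (suc n *_) (+-comm n 2) ⟩
  suc n * suc (suc n)           ∎
  where open ≡-Reasoning

triangular-double : ∀ a → triangular (a + a) ≡ a * suc (a + a)
triangular-double a = *-cancelˡ-≡ _ _ 2 (trans (2*triangular (a + a)) (double a))
  where
  double : ∀ a → (a + a) * suc (a + a) ≡ 2 * (a * suc (a + a))
  double = solve-∀

triangular-odd : ∀ a → triangular (suc (a + a)) ≡ suc a * suc (a + a)
triangular-odd a = begin
  triangular (suc (a + a))           ≡⟨ triangular-suc (a + a) ⟩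
  triangular (a + a) + suc (a + a)   ≡⟨ cong (_+ suc (a + a)) (triangular-double a) ⟩
  a * suc (a + a) + suc (a + a)      ≡⟨ +-comm _ (suc (a + a)) ⟩
  suc a * suc (a + a)                ∎
  where open ≡-Reasoning

injective⇒large-value : ∀ {r} (g : Fin (suc r) → ℕ) → Injective _≡_ _≡_ g → ∃ λ i → r ≤ g i
injective⇒large-value {r} g g-injective with any? (λ i → r ≤? g i)
... | yes large = large
... | no none = contradiction (injective⇒≤ below-r-injective) 1+n≰n
  where
  below-r : Fin (suc r) → Fin r
  below-r i = fromℕ< (≰⇒> (λ r≤gi → none (i , r≤gi)))
  below-r-injective : Injective _≡_ _≡_ below-r
  below-r-injective = g-injective ∘ fromℕ<-injective _ _ _ _

triangular≤∑-injective : ∀ {r} (g : Fin r → ℕ) → Injective _≡_ _≡_ g →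
  triangular r ≤ ∑[ i < r ] suc (g i)
triangular≤∑-injective {zero}  g g-injective = z≤n
triangular≤∑-injective {suc r} g g-injective with injective⇒large-value g g-injective
... | j , r≤gj = begin
  triangular (suc r)                           ≡⟨ triangular-suc r ⟩
  triangular r + suc r                         ≤⟨ +-mono-≤ rest-≥ (s≤s r≤gj) ⟩
  ∑[ i < r ] suc (removeAt g j i) + suc (g j)  ≡⟨ +-comm _ (suc (g j)) ⟩
  suc (g j) + ∑[ i < r ] suc (removeAt g j i)  ≡⟨ sum-remove {i = j} (suc ∘ g) ⟨
  ∑[ i < suc r ] suc (g i)                     ∎
  where
  open ≤-Reasoning
  rest-≥ = triangular≤∑-injective (removeAt g j) (punchIn-injective j _ _ ∘ g-injective)

∑ᴱ : ∀ {A : Set} {N} → A ↔ Fin N → (A → ℕ) → ℕ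
∑ᴱ {N = N} ε f = ∑[ x < N ] f (from ε x)

∑ᴱ-⊎ : ∀ {A B : Set} {M N} (ε : A ↔ Fin M) (δ : B ↔ Fin N) (g : A ⊎ B → ℕ) →
  ∑ᴱ (↔-sym +↔⊎ ↔-∘ (ε ⊎-↔ δ)) g ≡ ∑ᴱ ε (g ∘ inj₁) + ∑ᴱ δ (g ∘ inj₂)
∑ᴱ-⊎ {M = M} ε δ g = ∑-splitAt M (g ∘ Sum.map (from ε) (from δ))

∑ᴱ-permute : ∀ {A : Set} {N} (ε : A ↔ Fin N) (ν : A ↔ A) (f : A → ℕ) → ∑ᴱ ε (f ∘ to ν) ≡ ∑ᴱ ε f
∑ᴱ-permute ε ν f = sym (trans (∑-permute (f ∘ from ε) (ε ↔-∘ (ν ↔-∘ ↔-sym ε)))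
  (sum-cong-≗ (cong f ∘ Inverse.strictlyInverseʳ ε ∘ to ν ∘ from ε)))

∑ᴱ-suc-toℕ : ∀ {A : Set} {N M} (ε : A ↔ Fin N) (L : A ↔ Fin M) → ∑ᴱ ε (suc ∘ toℕ ∘ to L) ≡ triangular M
∑ᴱ-suc-toℕ ε L = sym (∑-permute (suc ∘ toℕ) (L ↔-∘ ↔-sym ε))

∑ᴱ-const : ∀ {A : Set} {N} (ε : A ↔ Fin N) a → ∑ᴱ ε (λ _ → a) ≡ N * a
∑ᴱ-const {N = N} ε a = ∑-const N a

∑ᴱ-distrib-+ : ∀ {A : Set} {N} (ε : A ↔ Fin N) (f g : A → ℕ) →
  ∑ᴱ ε (λ x → f x + g x) ≡ ∑ᴱ ε f + ∑ᴱ ε g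
∑ᴱ-distrib-+ ε f g = ∑-distrib-+ (f ∘ from ε) (g ∘ from ε)

injective⇒surjective : ∀ {r} {f : Fin r → Fin r} → Injective _≡_ _≡_ f → ∀ y → ∃ λ x → f x ≡ y
injective⇒surjective {suc r} {f} f-injective y with any? (λ x → f x ≟ y)
... | yes hit = hit
... | no miss = contradiction (injective⇒≤ avoid-y-injective) 1+n≰n
  where
  avoid-y : Fin (suc r) → Fin r
  avoid-y x = punchOut (λ y≡fx → miss (x , sym y≡fx))
  avoid-y-injective : Injective _≡_ _≡_ avoid-y
  avoid-y-injective = f-injective ∘ punchOut-injective {i = y} _ _

injective⇒↔ : ∀ {r} (f : Fin r → Fin r) → Injective _≡_ _≡_ f → Fin r ↔ Fin r
injective⇒↔ f f-injective = ⤖⇒↔ (mk⤖ (f-injective , λ y →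
  Product.map₂ (λ { fx≡y refl → fx≡y }) (injective⇒surjective f-injective y)))

module Restriction {r : ℕ} (f : ℕ → ℕ) (f-< : ∀ {t} → t < r → f t < r)
                   (f-injective : ∀ {t t′} → t < r → t′ < r → f t ≡ f t′ → t ≡ t′) where

  restrict : Fin r → Fin r
  restrict i = fromℕ< (f-< (toℕ<n i))

  toℕ-restrict : ∀ i → toℕ (restrict i) ≡ f (toℕ i)
  toℕ-restrict i = toℕ-fromℕ< _

  restrict↔ : Fin r ↔ Fin r
  restrict↔ = injective⇒↔ restrict λ {i} {j} eq → toℕ-injective (f-injective (toℕ<n i) (toℕ<n j)
    (trans (sym (toℕ-restrict i)) (trans (cong toℕ eq) (toℕ-restrict j))))

open Restriction using (restrict↔; toℕ-restrict)

vertex-edge-label-sum : ∀ {a b x h q} p → a + b ≡ h + x → x < q →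
  suc a + suc b + suc (p + (q ∸ suc x)) ≡ p + q + suc (suc h)
vertex-edge-label-sum {a} {b} {x} {h} {q} p a+b≡h+x x<q = begin
  suc a + suc b + suc (p + (q ∸ suc x))      ≡⟨ cong (λ y → suc y + suc (p + (q ∸ suc x))) (+-suc a b) ⟩
  suc (suc (a + b)) + suc (p + (q ∸ suc x))  ≡⟨ cong (λ y → suc (suc y) + suc (p + (q ∸ suc x))) a+b≡h+x ⟩
  suc (suc (h + x)) + suc (p + (q ∸ suc x))  ≡⟨ regroup h x p (q ∸ suc x) ⟩
  p + (suc x + (q ∸ suc x)) + suc (suc h)    ≡⟨ cong (λ y → p + y + suc (suc h)) (m+[n∸m]≡n x<q) ⟩
  p + q + suc (suc h)                        ∎
  where
  open ≡-Reasoning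
  regroup : ∀ h x p d → suc (suc (h + x)) + suc (p + d) ≡ p + (suc x + d) + suc (suc h)
  regroup = solve-∀

-- Edges are labelled in the reverse order of Ψ, which turns the constant
-- edge weight into Φ u + Φ v − Ψ e being constant.
semt-from-vertex-edge-bijections : (G : Graph) (h : ℕ) (Φ : V G ↔ Fin (p G)) (Ψ : E G ↔ Fin (q G)) →
  (∀ e → toℕ (to Φ (proj₁ (ends G e))) + toℕ (to Φ (proj₂ (ends G e))) ≡ h + toℕ (to Ψ e)) →
  HasSEMTWithConstant G (p G + q G + suc (suc h))
semt-from-vertex-edge-bijections G h Φ Ψ Φ-sum = L , vertex-label≤p , p<edge-label , magic
  where
  L : TotalLabeling G
  L = ↔⇒⤖ (↔-sym +↔⊎ ↔-∘ (Φ ⊎-↔ (reverse ↔-∘ Ψ)))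
  vertex-label : ∀ v → label G L (inj₁ v) ≡ suc (toℕ (to Φ v))
  vertex-label v = cong suc (toℕ-↑ˡ (to Φ v) (q G))
  edge-label : ∀ e → label G L (inj₂ e) ≡ suc (p G + (q G ∸ suc (toℕ (to Ψ e))))
  edge-label e = cong suc (trans (toℕ-↑ʳ (p G) _) (cong (p G +_) (opposite-prop (to Ψ e))))
  vertex-label≤p : ∀ v → label G L (inj₁ v) ≤ p G
  vertex-label≤p v = subst (_≤ p G) (sym (vertex-label v)) (toℕ<n (to Φ v))
  p<edge-label : ∀ e → p G < label G L (inj₂ e)
  p<edge-label e = subst (p G <_) (sym (edge-label e)) (s≤s (m≤m+n (p G) _))
  magic : ∀ e → label G L (inj₁ (proj₁ (ends G e))) + label G L (inj₁ (proj₂ (ends G e))) + label G L (inj₂ e)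
              ≡ p G + q G + suc (suc h)
  magic e = trans (cong₂ _+_ (cong₂ _+_ (vertex-label _) (vertex-label _)) (edge-label e))
                  (vertex-edge-label-sum (p G) (Φ-sum e) (toℕ<n (to Ψ e)))

-- The cycle and its zigzag labelling

toℕ-next-inject₁ : ∀ {m} (i : Fin m) → toℕ (next (inject₁ i)) ≡ suc (toℕ i)
toℕ-next-inject₁ {m} i = begin
  toℕ (next (inject₁ i))         ≡⟨ toℕ-fromℕ< _ ⟩
  suc (toℕ (inject₁ i)) % suc m  ≡⟨ cong (λ t → suc t % suc m) (toℕ-inject₁ i) ⟩
  suc (toℕ i) % suc m            ≡⟨ m<n⇒m%n≡m (s≤s (toℕ<n i)) ⟩
  suc (toℕ i)                    ∎
  where open ≡-Reasoning

toℕ-next-fromℕ : ∀ m → toℕ (next (fromℕ m)) ≡ 0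
toℕ-next-fromℕ m = trans (toℕ-fromℕ< _) (trans (cong (λ t → suc t % suc m) (toℕ-fromℕ m)) (n%n≡0 (suc m)))

next-injective : ∀ {m} → Injective _≡_ _≡_ (next {suc m})
next-injective {m} {i} {j} eq with view i | view j
... | ‵fromℕ      | ‵fromℕ      = refl
... | ‵inject₁ i′ | ‵inject₁ j′ = cong inject₁ (toℕ-injective (suc-injective (begin
  suc (toℕ i′)             ≡⟨ toℕ-next-inject₁ i′ ⟨
  toℕ (next (inject₁ i′))  ≡⟨ cong toℕ eq ⟩
  toℕ (next (inject₁ j′))  ≡⟨ toℕ-next-inject₁ j′ ⟩
  suc (toℕ j′)             ∎)))
  where open ≡-Reasoning
... | ‵fromℕ      | ‵inject₁ j′ with () ← trans (sym (toℕ-next-fromℕ m)) (trans (cong toℕ eq) (toℕ-next-inject₁ j′))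
... | ‵inject₁ i′ | ‵fromℕ      with () ← trans (sym (toℕ-next-inject₁ i′)) (trans (cong toℕ eq) (toℕ-next-fromℕ m))

next↔ : ∀ {m} → Fin (suc m) ↔ Fin (suc m)
next↔ = injective⇒↔ next next-injective

data Halves : ℕ → Set where
  even : ∀ s → Halves (s + s)
  odd  : ∀ s → Halves (suc (s + s))

halves : ∀ t → Halves t
halves zero          = even 0
halves (suc zero)    = odd 0
halves (suc (suc t)) with halves t
... | even s = subst Halves (cong suc (+-suc s s)) (even (suc s))
... | odd s  = subst Halves (cong (suc ∘ suc) (+-suc s s)) (odd (suc s))

m+m≤n+n⇒m≤n : ∀ {s h} → s + s ≤ h + h → s ≤ h
m+m≤n+n⇒m≤n le = ≮⇒≥ λ h<s → <⇒≱ (+-mono-< h<s h<s) le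

m+m<n+n⇒m<n : ∀ {s h} → s + s < h + h → s < h
m+m<n+n⇒m<n lt = ≰⇒> λ h≤s → <⇒≱ lt (+-mono-≤ h≤s h≤s)

zigzag : ℕ → ℕ → ℕ
zigzag h zero          = zero
zigzag h (suc zero)    = suc h
zigzag h (suc (suc t)) = suc (zigzag h t)

cozigzag : ℕ → ℕ → ℕ
cozigzag h zero          = h
cozigzag h (suc zero)    = zero
cozigzag h (suc (suc t)) = suc (cozigzag h t)

zigzag-even : ∀ h s → zigzag h (s + s) ≡ s
zigzag-even h zero    = refl
zigzag-even h (suc s) rewrite +-suc s s = cong suc (zigzag-even h s)

zigzag-odd : ∀ h s → zigzag h (suc (s + s)) ≡ suc (h + s)
zigzag-odd h zero    = cong suc (sym (+-identityʳ h))
zigzag-odd h (suc s) rewrite +-suc s s = cong suc (trans (zigzag-odd h s) (sym (+-suc h s)))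

zigzag-< : ∀ h {t} → t < suc (h + h) → zigzag h t < suc (h + h)
zigzag-< h {t} t< with halves t
... | even s rewrite zigzag-even h s = s≤s (≤-trans (m+m≤n+n⇒m≤n (≤-pred t<)) (m≤m+n h h))
... | odd s  rewrite zigzag-odd h s  = s≤s (+-monoʳ-< h (m+m<n+n⇒m<n (≤-pred t<)))

zigzag-injective : ∀ h {t t′} → t < suc (h + h) → t′ < suc (h + h) → zigzag h t ≡ zigzag h t′ → t ≡ t′
zigzag-injective h {t} {t′} t< t′< eq with halves t | halves t′
... | even s | even s′ rewrite zigzag-even h s | zigzag-even h s′ = cong (λ x → x + x) eq
... | odd s  | odd s′  rewrite zigzag-odd h s  | zigzag-odd h s′  =
  cong (λ x → suc (x + x)) (+-cancelˡ-≡ h s s′ (suc-injective eq))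
... | even s | odd s′  rewrite zigzag-even h s | zigzag-odd h s′  =
  contradiction (m+m≤n+n⇒m≤n (≤-pred t<)) (<⇒≱ (subst (h <_) (sym eq) (s≤s (m≤m+n h s′))))
... | odd s  | even s′ rewrite zigzag-odd h s  | zigzag-even h s′ =
  contradiction (m+m≤n+n⇒m≤n (≤-pred t′<)) (<⇒≱ (subst (h <_) eq (s≤s (m≤m+n h s))))

zigzag-step : ∀ h t → zigzag h t + zigzag h (suc t) ≡ h + suc t
zigzag-step h zero          = sym (+-comm h 1)
zigzag-step h (suc zero)    = sym (+-suc h 1)
zigzag-step h (suc (suc t)) = begin
  suc (zigzag h t) + suc (zigzag h (suc t))  ≡⟨ cong suc (+-suc (zigzag h t) (zigzag h (suc t))) ⟩
  suc (suc (zigzag h t + zigzag h (suc t)))  ≡⟨ cong (suc ∘ suc) (zigzag-step h t) ⟩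
  suc (suc (h + suc t))                      ≡⟨ cong suc (+-suc h (suc t)) ⟨
  suc (h + suc (suc t))                      ≡⟨ +-suc h (suc (suc t)) ⟨
  h + suc (suc (suc t))                      ∎
  where open ≡-Reasoning

zigzag-suc : ∀ h t → zigzag h (suc t) ≡ suc (cozigzag h t)
zigzag-suc h zero          = refl
zigzag-suc h (suc zero)    = refl
zigzag-suc h (suc (suc t)) = cong suc (zigzag-suc h t)

zigzag+cozigzag : ∀ h t → zigzag h t + cozigzag h t ≡ h + t
zigzag+cozigzag h t = suc-injective (begin
  suc (zigzag h t + cozigzag h t)   ≡⟨ +-suc (zigzag h t) (cozigzag h t) ⟨
  zigzag h t + suc (cozigzag h t)   ≡⟨ cong (zigzag h t +_) (zigzag-suc h t) ⟨
  zigzag h t + zigzag h (suc t)     ≡⟨ zigzag-step h t ⟩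
  h + suc t                         ≡⟨ +-suc h t ⟩
  suc (h + t)                       ∎)
  where open ≡-Reasoning

cozigzag-< : ∀ h {t} → t < h + h → cozigzag h t < h + h
cozigzag-< h {t} t< = ≤-pred (subst (_< suc (h + h)) (zigzag-suc h t) (zigzag-< h (s≤s t<)))

cozigzag-injective : ∀ h {t t′} → t < h + h → t′ < h + h → cozigzag h t ≡ cozigzag h t′ → t ≡ t′
cozigzag-injective h {t} {t′} t< t′< eq = suc-injective (zigzag-injective h (s≤s t<) (s≤s t′<)
  (trans (zigzag-suc h t) (trans (cong suc eq) (sym (zigzag-suc h t′)))))

zigzag-next : ∀ h (i : Fin (suc (h + h))) → zigzag h (toℕ i) + zigzag h (toℕ (next i)) ≡ h + toℕ (next i)
zigzag-next h i with view i
... | ‵inject₁ j rewrite toℕ-next-inject₁ j | toℕ-inject₁ j = zigzag-step h (toℕ j)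
... | ‵fromℕ = begin
  zigzag h (toℕ last) + zigzag h (toℕ (next last))
    ≡⟨ cong₂ (λ a b → zigzag h a + zigzag h b) (toℕ-fromℕ (h + h)) (toℕ-next-fromℕ (h + h)) ⟩
  zigzag h (h + h) + 0     ≡⟨ +-identityʳ _ ⟩
  zigzag h (h + h)         ≡⟨ zigzag-even h h ⟩
  h                        ≡⟨ +-identityʳ h ⟨
  h + 0                    ≡⟨ cong (h +_) (toℕ-next-fromℕ (h + h)) ⟨
  h + toℕ (next last)      ∎
  where
  open ≡-Reasoning
  last = fromℕ (h + h)

zigzag↔ : ∀ h → Fin (suc (h + h)) ↔ Fin (suc (h + h))
zigzag↔ h = restrict↔ (zigzag h) (zigzag-< h) (zigzag-injective h)

cozigzag↔ : ∀ h → Fin (h + h) ↔ Fin (h + h)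
cozigzag↔ h = restrict↔ (cozigzag h) (cozigzag-< h) (cozigzag-injective h)

toℕ-zigzag↔ : ∀ h i → toℕ (to (zigzag↔ h) i) ≡ zigzag h (toℕ i)
toℕ-zigzag↔ h = toℕ-restrict (zigzag h) (zigzag-< h) (zigzag-injective h)

toℕ-cozigzag↔ : ∀ h i → toℕ (to (cozigzag↔ h) i) ≡ cozigzag h (toℕ i)
toℕ-cozigzag↔ h = toℕ-restrict (cozigzag h) (cozigzag-< h) (cozigzag-injective h)

-- With n = n′ + 1 the vertices are listed as: the cycle a₁ … aₙ, the k − c
-- pendants of aₙ, then the k pendants of each of a₁ … aₙ₋₁ with the pendant
-- number as major index.  Permuting the cycle (σ) and a₁ … aₙ₋₁ (τ) inside
-- this order yields both the vertex and the edge labelling.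
module Layout (n′ k c : ℕ) where

  n N : ℕ
  n = suc n′
  N = n * (k + 1) ∸ c

  Vertex : Set
  Vertex = Fin n ⊎ Pendant n k c

  pendCount-fromℕ : pendCount n k c (fromℕ n′) ≡ k ∸ c
  pendCount-fromℕ rewrite toℕ-fromℕ n′ | dec-true (n ℕ.≟ n) refl = refl

  pendCount-inject₁ : ∀ i → pendCount n k c (inject₁ i) ≡ k
  pendCount-inject₁ i rewrite toℕ-inject₁ i | dec-false (suc (toℕ i) ℕ.≟ n) (<⇒≢ (s≤s (toℕ<n i))) = refl

  PendantLayout : Set
  PendantLayout = Fin (k ∸ c) ⊎ (Fin k × Fin n′)

  pendant-from : PendantLayout → Pendant n k c
  pendant-from (inj₁ j)       = fromℕ n′ , cast (sym pendCount-fromℕ) j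
  pendant-from (inj₂ (b , i)) = inject₁ i , cast (sym (pendCount-inject₁ i)) b

  pendant-to : Pendant n k c → PendantLayout
  pendant-to (i , j) with view i
  ... | ‵fromℕ      = inj₁ (cast pendCount-fromℕ j)
  ... | ‵inject₁ i′ = inj₂ (cast (pendCount-inject₁ i′) j , i′)

  pendant↔ : Pendant n k c ↔ PendantLayout
  pendant↔ = mk↔ₛ′ pendant-to pendant-from to∘from from∘to
    where
    to∘from : ∀ z → pendant-to (pendant-from z) ≡ z
    to∘from (inj₁ j) rewrite view-fromℕ n′ =
      cong inj₁ (cast-involutive pendCount-fromℕ (sym pendCount-fromℕ) j)
    to∘from (inj₂ (b , i)) rewrite view-inject₁ i =
      cong (λ b′ → inj₂ (b′ , i)) (cast-involutive (pendCount-inject₁ i) (sym (pendCount-inject₁ i)) b)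
    from∘to : ∀ x → pendant-from (pendant-to x) ≡ x
    from∘to (i , j) with view i
    ... | ‵fromℕ      = cong (fromℕ n′ ,_) (cast-involutive (sym pendCount-fromℕ) pendCount-fromℕ j)
    ... | ‵inject₁ i′ = cong (inject₁ i′ ,_) (cast-involutive (sym (pendCount-inject₁ i′)) (pendCount-inject₁ i′) j)

  owner : PendantLayout → Fin n
  owner = proj₁ ∘ pendant-from

  owner-pendant↔ : ∀ x → owner (to pendant↔ x) ≡ proj₁ x
  owner-pendant↔ x = cong proj₁ (Inverse.strictlyInverseʳ pendant↔ x)

  Size : ℕ
  Size = n + ((k ∸ c) + k * n′)

  Size≡N : c ≤ k → Size ≡ N
  Size≡N c≤k = begin
    n + ((k ∸ c) + k * n′)   ≡⟨ regroup n (k ∸ c) (k * n′) ⟩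
    n + k * n′ + (k ∸ c)     ≡⟨ +-∸-assoc (n + k * n′) c≤k ⟨
    n + k * n′ + k ∸ c       ≡⟨ cong (_∸ c) (expand n′ k) ⟩
    N                        ∎
    where
    open ≡-Reasoning
    regroup : ∀ a d b → a + (d + b) ≡ a + b + d
    regroup = solve-∀
    expand : ∀ n′ k → suc n′ + k * n′ + k ≡ suc n′ * (k + 1)
    expand = solve-∀

  pendantIndex : Fin n′ ↔ Fin n′ → PendantLayout ↔ Fin ((k ∸ c) + k * n′)
  pendantIndex τ = ↔-sym +↔⊎ ↔-∘ (↔-id _ ⊎-↔ (↔-sym *↔× ↔-∘ (↔-id _ ×-↔ τ)))

  pendantPosition : Fin n′ ↔ Fin n′ → PendantLayout → ℕ
  pendantPosition τ (inj₁ j)       = toℕ j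
  pendantPosition τ (inj₂ (b , i)) = (k ∸ c) + (n′ * toℕ b + toℕ (to τ i))

  toℕ-pendantIndex : ∀ τ z → toℕ (to (pendantIndex τ) z) ≡ pendantPosition τ z
  toℕ-pendantIndex τ (inj₁ j)       = toℕ-↑ˡ j (k * n′)
  toℕ-pendantIndex τ (inj₂ (b , i)) = trans (toℕ-↑ʳ (k ∸ c) _) (cong ((k ∸ c) +_) (toℕ-combine b (to τ i)))

  layout : Fin n ↔ Fin n → Fin n′ ↔ Fin n′ → Vertex ↔ Fin Size
  layout σ τ = ↔-sym +↔⊎ ↔-∘ (σ ⊎-↔ (pendantIndex τ ↔-∘ pendant↔))

  toℕ-layout-cycle : ∀ σ τ i → toℕ (to (layout σ τ) (inj₁ i)) ≡ toℕ (to σ i)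
  toℕ-layout-cycle σ τ i = toℕ-↑ˡ (to σ i) _

  toℕ-layout-pendant : ∀ σ τ x → toℕ (to (layout σ τ) (inj₂ x)) ≡ n + pendantPosition τ (to pendant↔ x)
  toℕ-layout-pendant σ τ x = trans (toℕ-↑ʳ n _) (cong (n +_) (toℕ-pendantIndex τ (to pendant↔ x)))

  ∑-layout : ∀ f → ∑ᴱ (layout (↔-id _) (↔-id _)) f ≡
    ∑[ i < n ] f (inj₁ i) + (∑[ j < k ∸ c ] f (inj₂ (pendant-from (inj₁ j)))
                           + ∑[ b < k ] ∑[ i < n′ ] f (inj₂ (pendant-from (inj₂ (b , i)))))
  ∑-layout f = begin
    ∑ᴱ (layout (↔-id _) (↔-id _)) f
      ≡⟨ ∑ᴱ-⊎ (↔-id _) (pendantIndex (↔-id _) ↔-∘ pendant↔) f ⟩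
    ∑[ i < n ] f (inj₁ i) + ∑ᴱ (pendantIndex (↔-id _)) (f ∘ inj₂ ∘ pendant-from)
      ≡⟨ cong (∑[ i < n ] f (inj₁ i) +_) (∑ᴱ-⊎ (↔-id _) (↔-sym *↔× ↔-∘ (↔-id _ ×-↔ ↔-id _)) (f ∘ inj₂ ∘ pendant-from)) ⟩
    ∑[ i < n ] f (inj₁ i) + (∑[ j < k ∸ c ] f (inj₂ (pendant-from (inj₁ j)))
                           + ∑[ x < k * n′ ] f (inj₂ (pendant-from (inj₂ (remQuot n′ x)))))
      ≡⟨ cong (λ s → ∑[ i < n ] f (inj₁ i) + (∑[ j < k ∸ c ] f (inj₂ (pendant-from (inj₁ j))) + s))
              (∑-remQuot k n′ (f ∘ inj₂ ∘ pendant-from ∘ inj₂)) ⟩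
    ∑[ i < n ] f (inj₁ i) + (∑[ j < k ∸ c ] f (inj₂ (pendant-from (inj₁ j)))
                           + ∑[ b < k ] ∑[ i < n′ ] f (inj₂ (pendant-from (inj₂ (b , i)))))  ∎
    where open ≡-Reasoning

-- The upper bound

module Construction (h k c : ℕ) (c≤k : c ≤ k) where
  open Layout (h + h) k c

  Φ Ψ : Vertex ↔ Fin N
  Φ = cast-id (Size≡N c≤k) ↔-∘ layout (zigzag↔ h) (cozigzag↔ h)
  Ψ = cast-id (Size≡N c≤k) ↔-∘ layout next↔ (↔-id _)

  toℕ-Φ-cycle : ∀ i → toℕ (to Φ (inj₁ i)) ≡ zigzag h (toℕ i)
  toℕ-Φ-cycle i = trans (toℕ-cast (Size≡N c≤k) _)
                        (trans (toℕ-layout-cycle (zigzag↔ h) (cozigzag↔ h) i) (toℕ-zigzag↔ h i))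

  toℕ-Ψ-cycle : ∀ i → toℕ (to Ψ (inj₁ i)) ≡ toℕ (next i)
  toℕ-Ψ-cycle i = trans (toℕ-cast (Size≡N c≤k) _) (toℕ-layout-cycle next↔ (↔-id _) i)

  toℕ-Φ-pendant : ∀ x → toℕ (to Φ (inj₂ x)) ≡ n + pendantPosition (cozigzag↔ h) (to pendant↔ x)
  toℕ-Φ-pendant x = trans (toℕ-cast (Size≡N c≤k) _) (toℕ-layout-pendant (zigzag↔ h) (cozigzag↔ h) x)

  toℕ-Ψ-pendant : ∀ x → toℕ (to Ψ (inj₂ x)) ≡ n + pendantPosition (↔-id _) (to pendant↔ x)
  toℕ-Ψ-pendant x = trans (toℕ-cast (Size≡N c≤k) _) (toℕ-layout-pendant next↔ (↔-id _) x)

  pendant-edge-sum : ∀ z → zigzag h (toℕ (owner z)) + (n + pendantPosition (cozigzag↔ h) z)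
                         ≡ h + (n + pendantPosition (↔-id _) z)
  pendant-edge-sum (inj₁ j) rewrite toℕ-fromℕ (h + h) | zigzag-even h h = refl
  pendant-edge-sum (inj₂ (b , i)) rewrite toℕ-inject₁ i | toℕ-cozigzag↔ h i = begin
    zigzag h t + (n + (K + (B + cozigzag h t)))    ≡⟨ pull-out (zigzag h t) n K B (cozigzag h t) ⟩
    (zigzag h t + cozigzag h t) + (n + (K + B))    ≡⟨ cong (_+ (n + (K + B))) (zigzag+cozigzag h t) ⟩
    (h + t) + (n + (K + B))                        ≡⟨ push-in h t n K B ⟩
    h + (n + (K + (B + t)))                        ∎
    where
    open ≡-Reasoning
    t = toℕ i
    K = k ∸ c
    B = (h + h) * toℕ b
    pull-out : ∀ a n K B s → a + (n + (K + (B + s))) ≡ (a + s) + (n + (K + B))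
    pull-out = solve-∀
    push-in : ∀ h t n K B → (h + t) + (n + (K + B)) ≡ h + (n + (K + (B + t)))
    push-in = solve-∀

  edge-sum : ∀ e → toℕ (to Φ (proj₁ (G-ends n k c e))) + toℕ (to Φ (proj₂ (G-ends n k c e)))
                 ≡ h + toℕ (to Ψ e)
  edge-sum (inj₁ i) = begin
    toℕ (to Φ (inj₁ i)) + toℕ (to Φ (inj₁ (next i)))  ≡⟨ cong₂ _+_ (toℕ-Φ-cycle i) (toℕ-Φ-cycle (next i)) ⟩
    zigzag h (toℕ i) + zigzag h (toℕ (next i))        ≡⟨ zigzag-next h i ⟩
    h + toℕ (next i)                                  ≡⟨ cong (h +_) (toℕ-Ψ-cycle i) ⟨
    h + toℕ (to Ψ (inj₁ i))                           ∎
    where open ≡-Reasoning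
  edge-sum (inj₂ x) = begin
    toℕ (to Φ (inj₁ (proj₁ x))) + toℕ (to Φ (inj₂ x))
      ≡⟨ cong₂ _+_ (trans (toℕ-Φ-cycle (proj₁ x)) (cong (zigzag h ∘ toℕ) (sym (owner-pendant↔ x))))
                   (toℕ-Φ-pendant x) ⟩
    zigzag h (toℕ (owner z)) + (n + pendantPosition (cozigzag↔ h) z)  ≡⟨ pendant-edge-sum z ⟩
    h + (n + pendantPosition (↔-id _) z)                              ≡⟨ cong (h +_) (toℕ-Ψ-pendant x) ⟨
    h + toℕ (to Ψ (inj₂ x))                                           ∎
    where
    open ≡-Reasoning
    z = to pendant↔ x

  semt : HasSEMTWithConstant G[ n , k ,- c ] (N + N + suc (suc h))
  semt = semt-from-vertex-edge-bijections G[ n , k ,- c ] h Φ Ψ edge-sum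

-- The lower bound

count-bound : ∀ {N m n h T} → N * m ≡ T + N * suc (N + N) → n + N * h ≤ T → 0 < n →
  N + N + suc (suc h) ≤ m
count-bound {N} {m} {n} {h} {T} count T≥ 0<n =
  subst (_≤ m) (sym (+-suc (N + N) (suc h))) (*-cancelˡ-< N _ _ (begin-strict
    N * (N + N + suc h)          ≡⟨ expand N h ⟩
    N * h + N * suc (N + N)      <⟨ +-monoˡ-< (N * suc (N + N)) (m<n+m (N * h) 0<n) ⟩
    n + N * h + N * suc (N + N)  ≤⟨ +-monoˡ-≤ (N * suc (N + N)) T≥ ⟩
    T + N * suc (N + N)          ≡⟨ count ⟨
    N * m                        ∎))
  where
  open ≤-Reasoning
  expand : ∀ N h → N * (N + N + suc h) ≡ N * h + N * suc (N + N)
  expand = solve-∀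

module LowerBound (h k c : ℕ) (c≤k : c ≤ k) (m : ℕ) (L : TotalLabeling G[ suc (h + h) , k ,- c ])
                  (L-semt : IsSEMTLabeling G[ suc (h + h) , k ,- c ] L m) where
  open Layout (h + h) k c

  Λ : (Vertex ⊎ Vertex) ↔ Fin (N + N)
  Λ = ⤖⇒↔ L

  lab : Vertex ⊎ Vertex → ℕ
  lab = label G[ n , k ,- c ] L

  ε : Vertex ↔ Fin Size
  ε = layout (↔-id _) (↔-id _)

  tail head : Vertex → Vertex
  tail e = proj₁ (G-ends n k c e)
  head e = proj₂ (G-ends n k c e)

  head≡next⊎id : ∀ e → head e ≡ to (next↔ ⊎-↔ ↔-id _) e
  head≡next⊎id (inj₁ i) = refl
  head≡next⊎id (inj₂ x) = refl

  ∑-heads : ∑ᴱ ε (lab ∘ inj₁ ∘ head) ≡ ∑ᴱ ε (lab ∘ inj₁)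
  ∑-heads = trans (sum-cong-≗ (cong (lab ∘ inj₁) ∘ head≡next⊎id ∘ from ε))
                  (∑ᴱ-permute ε (next↔ ⊎-↔ ↔-id _) (lab ∘ inj₁))

  ∑-all-labels : ∑ᴱ ε (lab ∘ inj₁) + ∑ᴱ ε (lab ∘ inj₂) ≡ triangular (N + N)
  ∑-all-labels = trans (sym (∑ᴱ-⊎ ε ε lab)) (∑ᴱ-suc-toℕ (↔-sym +↔⊎ ↔-∘ (ε ⊎-↔ ε)) Λ)

  Tails : ℕ
  Tails = ∑ᴱ ε (lab ∘ inj₁ ∘ tail)

  double-count : Size * m ≡ Tails + triangular (N + N)
  double-count = begin
    Size * m                                                                 ≡⟨ ∑ᴱ-const ε m ⟨
    ∑ᴱ ε (λ _ → m)                                                           ≡⟨ sum-cong-≗ (magic ∘ from ε) ⟨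
    ∑ᴱ ε (λ e → lab (inj₁ (tail e)) + lab (inj₁ (head e)) + lab (inj₂ e))
      ≡⟨ ∑ᴱ-distrib-+ ε (λ e → lab (inj₁ (tail e)) + lab (inj₁ (head e))) (lab ∘ inj₂) ⟩
    ∑ᴱ ε (λ e → lab (inj₁ (tail e)) + lab (inj₁ (head e))) + ∑ᴱ ε (lab ∘ inj₂)
      ≡⟨ cong (_+ ∑ᴱ ε (lab ∘ inj₂)) (∑ᴱ-distrib-+ ε (lab ∘ inj₁ ∘ tail) (lab ∘ inj₁ ∘ head)) ⟩
    Tails + ∑ᴱ ε (lab ∘ inj₁ ∘ head) + ∑ᴱ ε (lab ∘ inj₂)  ≡⟨ cong (λ s → Tails + s + ∑ᴱ ε (lab ∘ inj₂)) ∑-heads ⟩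
    Tails + ∑ᴱ ε (lab ∘ inj₁) + ∑ᴱ ε (lab ∘ inj₂)         ≡⟨ +-assoc Tails _ _ ⟩
    Tails + (∑ᴱ ε (lab ∘ inj₁) + ∑ᴱ ε (lab ∘ inj₂))       ≡⟨ cong (Tails +_) ∑-all-labels ⟩
    Tails + triangular (N + N)                            ∎
    where
    open ≡-Reasoning
    magic = proj₂ (proj₂ L-semt)

  cycle-label : Fin n → ℕ
  cycle-label i = toℕ (to Λ (inj₁ (inj₁ i)))

  cycle-label-injective : Injective _≡_ _≡_ cycle-label
  cycle-label-injective = inj₁-injective ∘ inj₁-injective ∘ Bijection.injective L ∘ toℕ-injective

  Tails-≥ : triangular n + k * triangular (h + h) ≤ Tails
  Tails-≥ = begin
    triangular n + k * triangular (h + h)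
      ≤⟨ +-mono-≤ (triangular≤∑-injective cycle-label cycle-label-injective)
                  (*-monoʳ-≤ k (triangular≤∑-injective (cycle-label ∘ inject₁)
                                                      (inject₁-injective ∘ cycle-label-injective))) ⟩
    ∑[ i < n ] w i + k * ∑[ i < h + h ] w (inject₁ i)         ≡⟨ cong (∑[ i < n ] w i +_) (∑-const k _) ⟨
    ∑[ i < n ] w i + ∑[ b < k ] ∑[ i < h + h ] w (inject₁ i)  ≤⟨ +-monoʳ-≤ (∑[ i < n ] w i) (m≤n+m _ _) ⟩
    ∑[ i < n ] w i + (∑[ j < k ∸ c ] w (fromℕ (h + h)) + ∑[ b < k ] ∑[ i < h + h ] w (inject₁ i))
                                                              ≡⟨ ∑-layout (lab ∘ inj₁ ∘ tail) ⟨
    Tails                                                     ∎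
    where
    open ≤-Reasoning
    w = suc ∘ cycle-label

  n+N*h≤Tails : n + N * h ≤ Tails
  n+N*h≤Tails = begin
    n + N * h                              ≤⟨ +-monoʳ-≤ n (*-monoˡ-≤ h (m∸n≤m (n * (k + 1)) c)) ⟩
    n + n * (k + 1) * h                    ≡⟨ regroup h k ⟩
    suc h * n + k * (h * n)                ≡⟨ cong₂ (λ a b → a + k * b) (triangular-odd h) (triangular-double h) ⟨
    triangular n + k * triangular (h + h)  ≤⟨ Tails-≥ ⟩
    Tails                                  ∎
    where
    open ≤-Reasoning
    regroup : ∀ h k → suc (h + h) + suc (h + h) * (k + 1) * h ≡ suc h * suc (h + h) + k * (h * suc (h + h))
    regroup = solve-∀

  strength-≥ : N + N + suc (suc h) ≤ m
  strength-≥ = count-bound {N}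
    (trans (cong (_* m) (sym (Size≡N c≤k))) (trans double-count (cong (Tails +_) (triangular-double N))))
    n+N*h≤Tails (s≤s z≤n)

sm-odd-cycle : ∀ h k c → c ≤ k → let N = suc (h + h) * (k + 1) ∸ c in
  IsSuperEdgeMagicTotal G[ suc (h + h) , k ,- c ] × IsSMStrength G[ suc (h + h) , k ,- c ] (N + N + suc (suc h))
sm-odd-cycle h k c c≤k = (_ , semt) , semt , λ m (L , L-semt) → LowerBound.strength-≥ h k c c≤k m L L-semt
  where open Construction h k c c≤k using (semt)

odd⇒suc-double : ∀ n → n % 2 ≡ 1 → n ≡ suc (n / 2 + n / 2)
odd⇒suc-double n n%2≡1 = trans (m≡m%n+[m/n]*n n 2)
  (cong₂ _+_ n%2≡1 (trans (*-comm (n / 2) 2) (cong (n / 2 +_) (+-identityʳ _))))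

strength-formula : ∀ h k c → let n = suc (h + h) ; N = n * (k + 1) ∸ c in
  2 * n * (k + 1) ∸ 2 * c + (n + 3) / 2 ≡ N + N + suc (suc h)
strength-formula h k c = cong₂ _+_ twice half
  where
  n = suc (h + h)
  twice : 2 * n * (k + 1) ∸ 2 * c ≡ (n * (k + 1) ∸ c) + (n * (k + 1) ∸ c)
  twice = trans (cong (_∸ 2 * c) (*-assoc 2 n (k + 1)))
                (trans (sym (*-distribˡ-∸ 2 (n * (k + 1)) c)) (cong ((n * (k + 1) ∸ c) +_) (+-identityʳ _)))
  n+3≡[h+2]*2 : ∀ h → suc (h + h) + 3 ≡ suc (suc h) * 2
  n+3≡[h+2]*2 = solve-∀
  half : (n + 3) / 2 ≡ suc (suc h)
  half = trans (cong (_/ 2) (n+3≡[h+2]*2 h)) (m*n/n≡m (suc (suc h)) 2)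

-- The argument does not need n ≥ 3, k ≥ 1 or c ≥ 1.
theorem3p1 : (n k c : ℕ) → 3 ≤ n → n % 2 ≡ 1 → 1 ≤ k → 1 ≤ c → c ≤ k →
    IsSuperEdgeMagicTotal G[ n , k ,- c ]
    × IsSMStrength G[ n , k ,- c ] (2 * n * (k + 1) ∸ 2 * c + (n + 3) / 2)
theorem3p1 n k c _ n-odd _ _ c≤k rewrite odd⇒suc-double n n-odd | strength-formula (n / 2) k c =
  sm-odd-cycle (n / 2) k c c≤k
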